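{- Let $d\ge1$, let $h_0,\ldots,h_d$ be histograms with bins $1,\ldots,n$ and the same total number $m$ of data points, and let $\mathcal{H}=(H_0,\ldots,H_d)$ be the family of their cumulative histograms, regarded as finite sets of dots. Then \[ {\rm EMD}(h_0,\ldots,h_d) = \frac{1}{d}\left( \sum_{0\le i<j\le d} {\rm EMD}(h_i,h_j) + \sum_{k=2}^{\lceil d/2\rceil} k(k-1)\cdot\#\big\{x\in\cup\mathcal{H} : \deg_{\mathcal{H}}(x) = k \text{ or } d-k+1\big\}\right). \]
   Context: A histogram is $h=(h(1),\ldots,h(n))$ with nonnegative integer entries summing to $m$. Its cumulative histogram $H$ has $H(j)=\sum_{i\le j}h(i)$ and is identified with the set of dots $\{(j,k)\in\mathbb{Z}^2: 1\le j\le n,\ 1\le k\le H(j)\}$. Moving one data point from bin $a$ to bin $b$ costs $|a-b|$ units of work; for any number of histograms, ${\rm EMD}(h_0,\ldots,h_d)$ is the minimum total work needed to transform all of them into one common histogram (for two histograms this is the classical earth mover's distance). $\cup\mathcal{H}=\bigcup_i H_i$, and $\deg_{\mathcal{H}}(x)=\#\{i: x\in H_i\}$. -}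

module Defs where

open import Data.Nat using (ℕ; zero; suc; _+_; _*_; _∸_; _≤_; _<_; _/_; _≡ᵇ_; _≤ᵇ_; _<ᵇ_)
open import Data.Nat.Base using (∣_-_∣)
open import Data.Fin using (Fin; toℕ)
open import Data.Vec using (Vec; lookup; updateAt; tabulate; sum; _∷_; [])
import Data.List as L
open import Data.Nat.ListAction using () renaming (sum to lsum)
open import Data.Bool using (Bool; true; false; if_then_else_; _∨_; _∧_)
open import Data.Product using (Σ; ∃; _×_)
open import Relation.Binary.PropositionalEquality using (_≡_)

-- A histogram with bins 1..n; bin b is represented by (b-1) : Fin n.
Hist : ℕ → Set
Hist n = Vec ℕ n

total : ∀ {n} → Hist n → ℕ
total h = sum h

Σfin : ∀ {r} → (Fin r → ℕ) → ℕ
Σfin f = sum (tabulate f)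

ind : Bool → ℕ
ind true = 1
ind false = 0

moveH : ∀ {n} → Hist n → Fin n → Fin n → Hist n
moveH h a b = updateAt (updateAt h a (_∸ 1)) b suc

data Steps {n : ℕ} : Hist n → Hist n → ℕ → Set where
  done : ∀ {h} → Steps h h 0
  step : ∀ {h h' w} (a b : Fin n) → 1 ≤ lookup h a →
         Steps (moveH h a b) h' w → Steps h h' (∣ toℕ a - toℕ b ∣ + w)

Achievable : ∀ {n r} → (Fin r → Hist n) → ℕ → Set
Achievable {n} {r} hs w =
  Σ (Hist n) λ g → Σ (Fin r → ℕ) λ ws →
    ((i : Fin r) → Steps (hs i) g (ws i)) × (Σfin ws ≡ w)

IsEMD : ∀ {n r} → (Fin r → Hist n) → ℕ → Set
IsEMD hs w = Achievable hs w × (∀ w' → Achievable hs w' → w ≤ w')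

pair : ∀ {n} → Hist n → Hist n → Fin 2 → Hist n
pair h h' = lookup (h ∷ h' ∷ [])

cum : ∀ {n} → Hist n → Fin n → ℕ
cum h j = Σfin (λ i → if toℕ i ≤ᵇ toℕ j then lookup h i else 0)

-- dot (j,k) (k ≥ 1) belongs to the cumulative histogram H iff k ≤ H(j)
inCum : ∀ {n} → Hist n → Fin n → ℕ → Bool
inCum h j k = k ≤ᵇ cum h j

deg : ∀ {n r} → (Fin r → Hist n) → Fin n → ℕ → ℕ
deg hs j k = Σfin (λ i → ind (inCum (hs i) j k))

-- #{ x ∈ ∪H : deg(x) = k or deg(x) = d - k + 1 }, for a family of d+1
-- histograms with m data points each (all dots (j,k) have 1 ≤ k ≤ m).
countDeg : ∀ {n d} → ℕ → (Fin (suc d) → Hist n) → ℕ → ℕ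
countDeg {n} {d} m hs k =
  Σfin {n} λ j → Σfin {m} λ k' →
    let x = deg hs j (suc (toℕ k')) in
    ind ((1 ≤ᵇ x) ∧ ((x ≡ᵇ k) ∨ (x ≡ᵇ (d + 1 ∸ k))))

ceilHalf : ℕ → ℕ
ceilHalf d = (d + 1) / 2

sumFrom2 : ℕ → (ℕ → ℕ) → ℕ
sumFrom2 top f = lsum (L.applyUpTo (λ i → f (2 + i)) (top ∸ 1))

sumPairs : ∀ {r} → (Fin r → Fin r → ℕ) → ℕ
sumPairs e = Σfin λ i → Σfin λ j → if toℕ i <ᵇ toℕ j then e i j else 0

{-# OPTIONS --safe #-}
module Submission where

-- Regard the cumulative histograms as sets of dots (j, k) with k ≤ m. Moving one point from bin a
-- to bin b changes the dot set by exactly |a − b| dots, so bringing every H_i to a common G costs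
-- at least Σ_i |H_i △ G|, and a dot of degree D contributes at least min(D, d + 1 − D) to this.
-- The majority set G = {x : 2 deg(x) ≥ d + 1} is again a cumulative histogram, and a greedy
-- transport reaches it at exactly that cost; hence EMD(h_0, …, h_d) = Σ_x min(D, d + 1 − D) and
-- EMD(h_i, h_j) = |H_i △ H_j|. The identity then holds dot by dot: with c = min(D, d + 1 − D),
-- d c = D (d + 1 − D) + c (c − 1), and D (d + 1 − D) is the number of pairs i < j the dot separates.

open import Defs
open import Data.Nat using (ℕ; zero; suc; _*_; _+_; _∸_; _≤_; _<_; _⊓_; _≤ᵇ_; _<ᵇ_; _≡ᵇ_; _/_; z≤n; s≤s)
open import Data.Nat.Base using (∣_-_∣)
open import Data.Nat.Properties
open import Data.Nat.DivMod using (m/n*n≤m; m*n/n≡m; /-monoˡ-≤)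
open import Data.Nat.Solver using (module +-*-Solver)
open import Data.Nat.ListAction using () renaming (sum to lsum)
open import Data.Fin using (Fin; toℕ; zero; suc; fromℕ)
open import Data.Fin.Properties using (toℕ<n)
open import Data.Vec using (lookup; updateAt; sum; _∷_; [])
import Data.List as L
open import Data.Bool using (Bool; true; false; if_then_else_; T; _∧_; _∨_)
open import Data.Bool.Properties using (T-∧; T-∨)
open import Data.Unit using (tt)
open import Data.Empty using (⊥-elim)
open import Data.Product using (Σ; _,_; proj₂)
open import Data.Sum using (_⊎_; inj₁; inj₂)
open import Function using (_∘_; _⇔_; mk⇔; Equivalence)
open import Relation.Nullary using (¬_)
open import Relation.Binary.PropositionalEquality
open import Algebra.Properties.Semiring.Sum +-*-semiring
  using (sum-cong-≗; sum-replicate-zero; ∑-distrib-+; ∑-comm; *-distribˡ-sum)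
  renaming (sum to ∑)
open +-*-Solver

Σfin≡∑ : ∀ {r} (f : Fin r → ℕ) → Σfin f ≡ ∑ f
Σfin≡∑ {zero} f = refl
Σfin≡∑ {suc r} f = cong (f zero +_) (Σfin≡∑ (f ∘ suc))

Σfin-cong : ∀ {r} {f g : Fin r → ℕ} → (∀ i → f i ≡ g i) → Σfin f ≡ Σfin g
Σfin-cong {f = f} {g} f≗g = trans (Σfin≡∑ f) (trans (sum-cong-≗ f≗g) (sym (Σfin≡∑ g)))

Σfin-mono : ∀ {r} {f g : Fin r → ℕ} → (∀ i → f i ≤ g i) → Σfin f ≤ Σfin g
Σfin-mono {zero} f≤g = z≤n
Σfin-mono {suc r} f≤g = +-mono-≤ (f≤g zero) (Σfin-mono (f≤g ∘ suc))

Σfin-zero : ∀ {r} {f : Fin r → ℕ} → (∀ i → f i ≡ 0) → Σfin f ≡ 0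
Σfin-zero {r} {f} f≗0 = trans (Σfin-cong {g = λ _ → 0} f≗0) (trans (Σfin≡∑ {r} (λ _ → 0)) (sum-replicate-zero r))

Σfin-distrib-+ : ∀ {r} (f g : Fin r → ℕ) → Σfin (λ i → f i + g i) ≡ Σfin f + Σfin g
Σfin-distrib-+ f g = begin
  Σfin (λ i → f i + g i) ≡⟨ Σfin≡∑ (λ i → f i + g i) ⟩
  ∑ (λ i → f i + g i)    ≡⟨ ∑-distrib-+ f g ⟩
  ∑ f + ∑ g              ≡⟨ cong₂ _+_ (Σfin≡∑ f) (Σfin≡∑ g) ⟨
  Σfin f + Σfin g        ∎
  where open ≡-Reasoning

Σfin-comm : ∀ {r s} (f : Fin r → Fin s → ℕ) →
  Σfin (λ i → Σfin (λ j → f i j)) ≡ Σfin (λ j → Σfin (λ i → f i j))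
Σfin-comm f = begin
  Σfin (λ i → Σfin (f i))          ≡⟨ trans (Σfin≡∑ (Σfin ∘ f)) (sum-cong-≗ (Σfin≡∑ ∘ f)) ⟩
  ∑ (λ i → ∑ (f i))                ≡⟨ ∑-comm f ⟩
  ∑ (λ j → ∑ (λ i → f i j))        ≡⟨ trans (Σfin≡∑ (λ j → Σfin (λ i → f i j))) (sum-cong-≗ (λ j → Σfin≡∑ (λ i → f i j))) ⟨
  Σfin (λ j → Σfin (λ i → f i j))  ∎
  where open ≡-Reasoning

*-distribˡ-Σfin : ∀ {r} c (f : Fin r → ℕ) → c * Σfin f ≡ Σfin (λ i → c * f i)
*-distribˡ-Σfin c f = begin
  c * Σfin f            ≡⟨ cong (c *_) (Σfin≡∑ f) ⟩
  c * ∑ f               ≡⟨ *-distribˡ-sum c f ⟩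
  ∑ (λ i → c * f i)     ≡⟨ Σfin≡∑ (λ i → c * f i) ⟨
  Σfin (λ i → c * f i)  ∎
  where open ≡-Reasoning

Σfin-rotate : ∀ {r s t} (f : Fin r → Fin s → Fin t → ℕ) →
  Σfin (λ j → Σfin (λ k → Σfin (λ i → f i j k))) ≡ Σfin (λ i → Σfin (λ j → Σfin (λ k → f i j k)))
Σfin-rotate f = trans (Σfin-cong (λ j → Σfin-comm (λ k i → f i j k))) (Σfin-comm (λ j i → Σfin (f i j)))

Σfin²-distrib-+ : ∀ {r s} (f g : Fin r → Fin s → ℕ) →
  Σfin (λ j → Σfin (λ k → f j k + g j k)) ≡ Σfin (λ j → Σfin (f j)) + Σfin (λ j → Σfin (g j))
Σfin²-distrib-+ f g = trans (Σfin-cong (λ j → Σfin-distrib-+ (f j) (g j))) (Σfin-distrib-+ (λ j → Σfin (f j)) (λ j → Σfin (g j)))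

*-distribˡ-Σfin² : ∀ {r s} c (f : Fin r → Fin s → ℕ) → c * Σfin (λ j → Σfin (f j)) ≡ Σfin (λ j → Σfin (λ k → c * f j k))
*-distribˡ-Σfin² c f = trans (*-distribˡ-Σfin c (λ j → Σfin (f j))) (Σfin-cong (λ j → *-distribˡ-Σfin c (f j)))

Σfin-const-1 : ∀ r → Σfin {r} (λ _ → 1) ≡ r
Σfin-const-1 zero = refl
Σfin-const-1 (suc r) = cong suc (Σfin-const-1 r)

Σfin-if : ∀ {r} (b : Bool) (f : Fin r → ℕ) →
  (if b then Σfin f else 0) ≡ Σfin (λ i → if b then f i else 0)
Σfin-if true f = refl
Σfin-if {r} false f = sym (Σfin-zero {r} (λ _ → refl))

ind≤1 : ∀ b → ind b ≤ 1
ind≤1 true = ≤-refl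
ind≤1 false = z≤n

ind-mono : ∀ {b b′} → (T b → T b′) → ind b ≤ ind b′
ind-mono {false} _ = z≤n
ind-mono {true} {true} _ = ≤-refl
ind-mono {true} {false} b⇒b′ = ⊥-elim (b⇒b′ tt)

ind-≤ᵇ-mono : ∀ {a a′ x x′} → a′ ≤ a → x ≤ x′ → ind (a ≤ᵇ x) ≤ ind (a′ ≤ᵇ x′)
ind-≤ᵇ-mono {a} {a′} {x} a′≤a x≤x′ = ind-mono (λ a≤x → ≤⇒≤ᵇ (≤-trans a′≤a (≤-trans (≤ᵇ⇒≤ a x a≤x) x≤x′)))

T⇒ind≡1 : ∀ {b} → T b → ind b ≡ 1
T⇒ind≡1 {true} _ = refl

¬T⇒ind≡0 : ∀ {b} → ¬ T b → ind b ≡ 0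
¬T⇒ind≡0 {false} _ = refl
¬T⇒ind≡0 {true} ¬t = ⊥-elim (¬t tt)

count : ∀ {r} → (Fin r → Bool) → ℕ
count B = Σfin (ind ∘ B)

count≤ : ∀ {r} (B : Fin r → Bool) → count B ≤ r
count≤ {r} B = ≤-trans (Σfin-mono (ind≤1 ∘ B)) (≤-reflexive (Σfin-const-1 r))

count-all : ∀ {r} (B : Fin r → Bool) → (∀ i → T (B i)) → count B ≡ r
count-all {r} B all = trans (Σfin-cong (T⇒ind≡1 ∘ all)) (Σfin-const-1 r)

Σfin-∣ind-0∣ : ∀ {r} (B : Fin r → Bool) → Σfin (λ i → ∣ ind (B i) - 0 ∣) ≡ count B
Σfin-∣ind-0∣ B = Σfin-cong (∣-∣-identityʳ ∘ ind ∘ B)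

Σfin-∣ind-1∣ : ∀ {r} (B : Fin r → Bool) → Σfin (λ i → ∣ ind (B i) - 1 ∣) ≡ r ∸ count B
Σfin-∣ind-1∣ {zero} B = refl
Σfin-∣ind-1∣ {suc r} B with B zero
... | true = Σfin-∣ind-1∣ (B ∘ suc)
... | false = trans (cong suc (Σfin-∣ind-1∣ (B ∘ suc))) (sym (+-∸-assoc 1 (count≤ (B ∘ suc))))

minority≤disagreement : ∀ {r} (B : Fin r → Bool) c →
  count B ⊓ (r ∸ count B) ≤ Σfin (λ i → ∣ ind (B i) - ind c ∣)
minority≤disagreement B true = ≤-trans (m⊓n≤n _ _) (≤-reflexive (sym (Σfin-∣ind-1∣ B)))
minority≤disagreement B false = ≤-trans (m⊓n≤m _ _) (≤-reflexive (sym (Σfin-∣ind-0∣ B)))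

majority : ∀ {r} → (Fin r → Bool) → Bool
majority {r} B = r ≤ᵇ count B + count B

majority-mono : ∀ {r} {B B′ : Fin r → Bool} → count B ≤ count B′ → T (majority B) → T (majority B′)
majority-mono {r} {B} c≤c′ maj = ≤⇒≤ᵇ (≤-trans (≤ᵇ⇒≤ r (count B + count B) maj) (+-mono-≤ c≤c′ c≤c′))

disagreement-majority : ∀ {r} (B : Fin r → Bool) →
  Σfin (λ i → ∣ ind (B i) - ind (majority B) ∣) ≡ count B ⊓ (r ∸ count B)
disagreement-majority {r} B with r ≤ᵇ count B + count B in eq
... | true = trans (Σfin-∣ind-1∣ B) (sym (m≥n⇒m⊓n≡n r∸S≤S))
  where
  r∸S≤S : r ∸ count B ≤ count B
  r∸S≤S = ≤-trans (∸-monoˡ-≤ (count B) (≤ᵇ⇒≤ r (count B + count B) (subst T (sym eq) tt))) (≤-reflexive (m+n∸n≡m (count B) (count B)))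
... | false = trans (Σfin-∣ind-0∣ B) (sym (m≤n⇒m⊓n≡m S≤r∸S))
  where
  S≤r∸S : count B ≤ r ∸ count B
  S≤r∸S = m+n≤o⇒m≤o∸n (count B) (<⇒≤ (≰⇒> {r} {count B + count B} (λ r≤2S → subst T eq (≤⇒≤ᵇ r≤2S))))

Σfin-pairs-∣ind-ind∣ : ∀ {r} (B : Fin r → Bool) →
  Σfin (λ i → Σfin (λ i′ → if toℕ i <ᵇ toℕ i′ then ∣ ind (B i) - ind (B i′) ∣ else 0))
    ≡ count B * (r ∸ count B)
Σfin-pairs-∣ind-ind∣ {zero} B = refl
Σfin-pairs-∣ind-ind∣ {suc r} B with B zero
... | true = cong₂ _+_ (trans (Σfin-cong (λ i → ∣-∣-comm 1 (ind (B (suc i))))) (Σfin-∣ind-1∣ (B ∘ suc)))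
                        (Σfin-pairs-∣ind-ind∣ (B ∘ suc))
... | false = begin
  S + Σfin (λ i → Σfin (λ i′ → if toℕ i <ᵇ toℕ i′ then ∣ ind (B (suc i)) - ind (B (suc i′)) ∣ else 0))
                          ≡⟨ cong (S +_) (Σfin-pairs-∣ind-ind∣ (B ∘ suc)) ⟩
  S + S * (r ∸ S)         ≡⟨ *-suc S (r ∸ S) ⟨
  S * suc (r ∸ S)         ≡⟨ cong (S *_) (+-∸-assoc 1 (count≤ (B ∘ suc))) ⟨
  S * (suc r ∸ S)         ∎
  where
  open ≡-Reasoning
  S = count (B ∘ suc)

Σfin-∣ind≤ᵇ-ind≤ᵇ∣ : ∀ m x y →
  Σfin {m} (λ k → ∣ ind (suc (toℕ k) ≤ᵇ x) - ind (suc (toℕ k) ≤ᵇ y) ∣) ≡ ∣ x ⊓ m - y ⊓ m ∣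
Σfin-∣ind≤ᵇ-ind≤ᵇ∣ zero x y rewrite ⊓-zeroʳ x | ⊓-zeroʳ y = refl
Σfin-∣ind≤ᵇ-ind≤ᵇ∣ (suc m) zero zero = Σfin-∣ind≤ᵇ-ind≤ᵇ∣ m zero zero
Σfin-∣ind≤ᵇ-ind≤ᵇ∣ (suc m) zero (suc y) = cong suc (Σfin-∣ind≤ᵇ-ind≤ᵇ∣ m zero y)
Σfin-∣ind≤ᵇ-ind≤ᵇ∣ (suc m) (suc x) zero = cong suc (trans (Σfin-∣ind≤ᵇ-ind≤ᵇ∣ m x zero) (∣-∣-identityʳ _))
Σfin-∣ind≤ᵇ-ind≤ᵇ∣ (suc m) (suc x) (suc y) = Σfin-∣ind≤ᵇ-ind≤ᵇ∣ m x y

∣m⊓o-n⊓o∣≤∣m-n∣ : ∀ m n o → ∣ m ⊓ o - n ⊓ o ∣ ≤ ∣ m - n ∣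
∣m⊓o-n⊓o∣≤∣m-n∣ m n zero rewrite ⊓-zeroʳ m | ⊓-zeroʳ n = z≤n
∣m⊓o-n⊓o∣≤∣m-n∣ zero zero (suc o) = z≤n
∣m⊓o-n⊓o∣≤∣m-n∣ zero (suc n) (suc o) = s≤s (m⊓n≤m n o)
∣m⊓o-n⊓o∣≤∣m-n∣ (suc m) zero (suc o) = s≤s (m⊓n≤m m o)
∣m⊓o-n⊓o∣≤∣m-n∣ (suc m) (suc n) (suc o) = ∣m⊓o-n⊓o∣≤∣m-n∣ m n o

Antitone : (ℕ → Bool) → Set
Antitone c = ∀ k → T (c (suc k)) → T (c k)

-- An antitone predicate on {0, …, m−1} holds exactly on an initial segment, whose length is its count.
ind≤ᵇ-count-antitone : ∀ m (c : ℕ → Bool) → Antitone c → (k : Fin m) →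
  ind (suc (toℕ k) ≤ᵇ Σfin {m} (λ k′ → ind (c (toℕ k′)))) ≡ ind (c (toℕ k))
ind≤ᵇ-count-antitone (suc m) c anti k with c 0 in c0
ind≤ᵇ-count-antitone (suc m) c anti zero | true = cong ind (sym c0)
ind≤ᵇ-count-antitone (suc m) c anti (suc k) | true = ind≤ᵇ-count-antitone m (c ∘ suc) (anti ∘ suc) k
ind≤ᵇ-count-antitone (suc m) c anti k | false = begin
  ind (suc (toℕ k) ≤ᵇ Σfin {m} (λ k′ → ind (c (suc (toℕ k′)))))
    ≡⟨ cong (λ s → ind (suc (toℕ k) ≤ᵇ s)) (Σfin-zero {m} (λ k′ → ¬T⇒ind≡0 (never (suc (toℕ k′))))) ⟩
  0 ≡⟨ sym (¬T⇒ind≡0 (never (toℕ k))) ⟩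
  ind (c (toℕ k)) ∎
  where
  open ≡-Reasoning
  never : ∀ k → ¬ T (c k)
  never zero = subst T c0
  never (suc k) = never k ∘ anti k

-- Prefix sums and the cost of a move

prefixSum : ∀ {n} → Hist n → Fin n → ℕ
prefixSum (x ∷ h) zero = x
prefixSum (x ∷ h) (suc j) = x + prefixSum h j

cum≡prefixSum : ∀ {n} (h : Hist n) j → cum h j ≡ prefixSum h j
cum≡prefixSum {suc n} (x ∷ h) zero = trans (cong (x +_) (Σfin-zero {n} (λ _ → refl))) (+-identityʳ x)
cum≡prefixSum (x ∷ h) (suc j) = cong (x +_) (trans (Σfin-cong drop-suc) (cum≡prefixSum h j))
  where
  drop-suc : ∀ i → (if suc (toℕ i) ≤ᵇ suc (toℕ j) then lookup h i else 0)
                 ≡ (if toℕ i ≤ᵇ toℕ j then lookup h i else 0)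
  drop-suc i with toℕ i
  ... | zero = refl
  ... | suc _ = refl

prefixSum≤sum : ∀ {n} (h : Hist n) j → prefixSum h j ≤ sum h
prefixSum≤sum (x ∷ h) zero = m≤m+n x (sum h)
prefixSum≤sum (x ∷ h) (suc j) = +-monoʳ-≤ x (prefixSum≤sum h j)

prefixSum-last : ∀ {n} (h : Hist (suc n)) → prefixSum h (fromℕ n) ≡ sum h
prefixSum-last {zero} (x ∷ []) = sym (+-identityʳ x)
prefixSum-last {suc n} (x ∷ h) = cong (x +_) (prefixSum-last h)

prefixSum-mono : ∀ {n} (h : Hist n) {j j' : Fin n} → toℕ j ≤ toℕ j' → prefixSum h j ≤ prefixSum h j'
prefixSum-mono (x ∷ h) {zero} {zero} _ = ≤-refl
prefixSum-mono (x ∷ h) {zero} {suc j'} _ = m≤m+n x _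
prefixSum-mono (x ∷ h) {suc j} {suc j'} (s≤s j≤j') = +-monoʳ-≤ x (prefixSum-mono h j≤j')

cumDist : ∀ {n} → Hist n → Hist n → ℕ
cumDist h g = Σfin (λ j → ∣ prefixSum h j - prefixSum g j ∣)

cumDist-sym : ∀ {n} (h g : Hist n) → cumDist h g ≡ cumDist g h
cumDist-sym h g = Σfin-cong (λ j → ∣-∣-comm (prefixSum h j) (prefixSum g j))

_≤ᶠ_ : ∀ {n} → Fin n → Fin n → Bool
zero ≤ᶠ _ = true
suc a ≤ᶠ zero = false
suc a ≤ᶠ suc j = a ≤ᶠ j

prefixSum-incr : ∀ {n} (h : Hist n) b j → prefixSum (updateAt h b suc) j ≡ prefixSum h j + ind (b ≤ᶠ j)
prefixSum-incr (x ∷ h) zero zero = +-comm 1 x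
prefixSum-incr (x ∷ h) zero (suc j) = +-comm 1 (x + prefixSum h j)
prefixSum-incr (x ∷ h) (suc b) zero = sym (+-identityʳ x)
prefixSum-incr (x ∷ h) (suc b) (suc j) = trans (cong (x +_) (prefixSum-incr h b j)) (sym (+-assoc x _ _))

prefixSum-decr : ∀ {n} (h : Hist n) a j → 1 ≤ lookup h a →
  prefixSum (updateAt h a (_∸ 1)) j + ind (a ≤ᶠ j) ≡ prefixSum h j
prefixSum-decr (suc x ∷ h) zero zero _ = +-comm x 1
prefixSum-decr (suc x ∷ h) zero (suc j) _ = +-comm (x + prefixSum h j) 1
prefixSum-decr (x ∷ h) (suc a) zero _ = +-identityʳ x
prefixSum-decr (x ∷ h) (suc a) (suc j) ha = trans (+-assoc x _ _) (cong (x +_) (prefixSum-decr h a j ha))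

prefixSum-moveH : ∀ {n} (h : Hist n) a b j → 1 ≤ lookup h a →
  prefixSum (moveH h a b) j + ind (a ≤ᶠ j) ≡ prefixSum h j + ind (b ≤ᶠ j)
prefixSum-moveH h a b j ha = begin
  prefixSum (updateAt h′ b suc) j + [a≤j]  ≡⟨ cong (_+ [a≤j]) (prefixSum-incr h′ b j) ⟩
  prefixSum h′ j + [b≤j] + [a≤j]           ≡⟨ +-assoc (prefixSum h′ j) [b≤j] [a≤j] ⟩
  prefixSum h′ j + ([b≤j] + [a≤j])         ≡⟨ cong (prefixSum h′ j +_) (+-comm [b≤j] [a≤j]) ⟩
  prefixSum h′ j + ([a≤j] + [b≤j])         ≡⟨ +-assoc (prefixSum h′ j) [a≤j] [b≤j] ⟨
  prefixSum h′ j + [a≤j] + [b≤j]           ≡⟨ cong (_+ [b≤j]) (prefixSum-decr h a j ha) ⟩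
  prefixSum h j + [b≤j]                    ∎
  where
  open ≡-Reasoning
  h′ = updateAt h a (_∸ 1)
  [a≤j] = ind (a ≤ᶠ j)
  [b≤j] = ind (b ≤ᶠ j)

∣m-n∣≡∣p-q∣ : ∀ m n p q → n + p ≡ m + q → ∣ m - n ∣ ≡ ∣ p - q ∣
∣m-n∣≡∣p-q∣ m n p q eq = begin
  ∣ m - n ∣          ≡⟨ ∣m+n-m+o∣≡∣n-o∣ q m n ⟨
  ∣ q + m - q + n ∣  ≡⟨ cong₂ ∣_-_∣ (+-comm q m) (+-comm q n) ⟩
  ∣ m + q - n + q ∣  ≡⟨ cong (λ t → ∣ t - n + q ∣) eq ⟨
  ∣ n + p - n + q ∣  ≡⟨ ∣m+n-m+o∣≡∣n-o∣ n p q ⟩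
  ∣ p - q ∣          ∎
  where open ≡-Reasoning

Σfin-∣1-ind≤ᶠ∣ : ∀ {n} (b : Fin n) → Σfin (λ j → ∣ 1 - ind (b ≤ᶠ j) ∣) ≡ toℕ b
Σfin-∣1-ind≤ᶠ∣ {suc n} zero = Σfin-zero {suc n} (λ _ → refl)
Σfin-∣1-ind≤ᶠ∣ (suc b) = cong suc (Σfin-∣1-ind≤ᶠ∣ b)

Σfin-∣ind≤ᶠ-ind≤ᶠ∣ : ∀ {n} (a b : Fin n) → Σfin (λ j → ∣ ind (a ≤ᶠ j) - ind (b ≤ᶠ j) ∣) ≡ ∣ toℕ a - toℕ b ∣
Σfin-∣ind≤ᶠ-ind≤ᶠ∣ {suc n} zero zero = Σfin-zero {suc n} (λ _ → refl)
Σfin-∣ind≤ᶠ-ind≤ᶠ∣ zero (suc b) = cong suc (Σfin-∣1-ind≤ᶠ∣ b)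
Σfin-∣ind≤ᶠ-ind≤ᶠ∣ (suc a) zero =
  cong suc (trans (Σfin-cong (λ j → ∣-∣-comm (ind (a ≤ᶠ j)) 1)) (Σfin-∣1-ind≤ᶠ∣ a))
Σfin-∣ind≤ᶠ-ind≤ᶠ∣ (suc a) (suc b) = Σfin-∣ind≤ᶠ-ind≤ᶠ∣ a b

cumDist-moveH : ∀ {n} (h : Hist n) a b → 1 ≤ lookup h a → cumDist h (moveH h a b) ≡ ∣ toℕ a - toℕ b ∣
cumDist-moveH h a b ha = trans
  (Σfin-cong (λ j → ∣m-n∣≡∣p-q∣ (prefixSum h j) (prefixSum (moveH h a b) j) _ _ (prefixSum-moveH h a b j ha)))
  (Σfin-∣ind≤ᶠ-ind≤ᶠ∣ a b)

cumDist≤work : ∀ {n} {h g : Hist n} {w} → Steps h g w → cumDist h g ≤ w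
cumDist≤work {h = h} done = ≤-reflexive (Σfin-zero (λ j → ∣n-n∣≡0 (prefixSum h j)))
cumDist≤work {h = h} {g} (step {w = w} a b ha rest) = begin
  cumDist h g                         ≤⟨ Σfin-mono (λ j → ∣-∣-triangle (prefixSum h j) (prefixSum h′ j) (prefixSum g j)) ⟩
  Σfin (λ j → ∣ prefixSum h j - prefixSum h′ j ∣ + ∣ prefixSum h′ j - prefixSum g j ∣)
      ≡⟨ Σfin-distrib-+ (λ j → ∣ prefixSum h j - prefixSum h′ j ∣) (λ j → ∣ prefixSum h′ j - prefixSum g j ∣) ⟩
  cumDist h h′ + cumDist h′ g         ≤⟨ +-mono-≤ (≤-reflexive (cumDist-moveH h a b ha)) (cumDist≤work rest) ⟩
  ∣ toℕ a - toℕ b ∣ + w               ∎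
  where
  open ≤-Reasoning
  h′ = moveH h a b

-- Greedy transport

steps-∷ : ∀ {n} x {h g : Hist n} {w} → Steps h g w → Steps (x ∷ h) (x ∷ g) w
steps-∷ x done = done
steps-∷ x (step a b ha rest) = step (suc a) (suc b) ha (steps-∷ x rest)

steps-snoc : ∀ {n} {h g : Hist n} {w} → Steps h g w → (a b : Fin n) → 1 ≤ lookup g a →
  Steps h (moveH g a b) (w + ∣ toℕ a - toℕ b ∣)
steps-snoc {g = g} done a b ga = subst (Steps g (moveH g a b)) (+-identityʳ _) (step a b ga done)
steps-snoc {h = h} {g} (step {w = w} a′ b′ ha rest) a b ga =
  subst (Steps h (moveH g a b)) (sym (+-assoc ∣ toℕ a′ - toℕ b′ ∣ w _)) (step a′ b′ ha (steps-snoc rest a b ga))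

cumDist-∷ : ∀ {n} x (h g : Hist n) → cumDist (x ∷ h) (x ∷ g) ≡ cumDist h g
cumDist-∷ x h g = cong₂ _+_ (∣n-n∣≡0 x) (Σfin-cong (λ j → ∣m+n-m+o∣≡∣n-o∣ x (prefixSum h j) (prefixSum g j)))

-- Shifting a surplus point from the first bin to the second lowers only the first prefix sum, towards y.
cumDist-shift : ∀ {n} x z (h : Hist n) y (g : Hist (suc n)) k → x ≡ y + k →
  cumDist (suc x ∷ z ∷ h) (y ∷ g) ≡ suc (cumDist (x ∷ suc z ∷ h) (y ∷ g))
cumDist-shift x z h y g k refl = cong₂ _+_ (head y) (Σfin-cong tail)
  where
  head : ∀ y → ∣ suc (y + k) - y ∣ ≡ suc ∣ y + k - y ∣
  head zero = cong suc (sym (∣-∣-identityʳ k))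
  head (suc y) = head y
  tail : ∀ j → ∣ suc (y + k) + prefixSum (z ∷ h) j - y + prefixSum g j ∣
             ≡ ∣ y + k + prefixSum (suc z ∷ h) j - y + prefixSum g j ∣
  tail zero = cong (λ t → ∣ t - y + prefixSum g zero ∣) (sym (+-suc (y + k) z))
  tail (suc j) = cong (λ t → ∣ t - y + prefixSum g (suc j) ∣) (sym (+-suc (y + k) (z + prefixSum h j)))

mutual
  -- Settle the first bin: a surplus is shifted into the second bin first, a deficit is pulled from it last.
  steps-cumDist : ∀ {n} (h g : Hist n) → sum h ≡ sum g → Steps h g (cumDist h g)
  steps-cumDist [] [] _ = done
  steps-cumDist (x ∷ h) (y ∷ g) eq with ≤-total x y
  ... | inj₁ x≤y = steps-pull (y ∸ x) x y h g (sym (m+[n∸m]≡n x≤y)) eq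
  ... | inj₂ y≤x = steps-push (x ∸ y) x y h g (sym (m+[n∸m]≡n y≤x)) eq

  steps-push : ∀ {n} k x y (h g : Hist n) → x ≡ y + k → x + sum h ≡ y + sum g →
    Steps (x ∷ h) (y ∷ g) (cumDist (x ∷ h) (y ∷ g))
  steps-push zero x y h g x≡y+0 eq rewrite trans x≡y+0 (+-identityʳ y) =
    subst (Steps (y ∷ h) (y ∷ g)) (sym (cumDist-∷ y h g)) (steps-∷ y (steps-cumDist h g (+-cancelˡ-≡ y _ _ eq)))
  steps-push (suc k) zero y h g x≡ eq = ⊥-elim (0≢1+n (trans x≡ (+-suc y k)))
  steps-push (suc k) (suc x) y [] [] x≡ eq =
    ⊥-elim (m+1+n≢m y (trans (sym x≡) (trans (sym (+-identityʳ (suc x))) (trans eq (+-identityʳ y)))))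
  steps-push (suc k) (suc x) y (z ∷ h) g x≡ eq =
    subst (Steps (suc x ∷ z ∷ h) (y ∷ g)) (sym (cumDist-shift x z h y g k x≡y+k))
      (step zero (suc zero) (s≤s z≤n)
        (steps-push k x y (suc z ∷ h) g x≡y+k (trans (+-suc x (z + sum h)) eq)))
    where
    x≡y+k : x ≡ y + k
    x≡y+k = suc-injective (trans x≡ (+-suc y k))

  steps-pull : ∀ {n} k x y (h g : Hist n) → y ≡ x + k → x + sum h ≡ y + sum g →
    Steps (x ∷ h) (y ∷ g) (cumDist (x ∷ h) (y ∷ g))
  steps-pull zero x y h g y≡x+0 eq rewrite trans y≡x+0 (+-identityʳ x) =
    subst (Steps (x ∷ h) (x ∷ g)) (sym (cumDist-∷ x h g)) (steps-∷ x (steps-cumDist h g (+-cancelˡ-≡ x _ _ eq)))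
  steps-pull (suc k) x zero h g y≡ eq = ⊥-elim (0≢1+n (trans y≡ (+-suc x k)))
  steps-pull (suc k) x (suc y) [] [] y≡ eq =
    ⊥-elim (m+1+n≢m x (trans (sym y≡) (trans (sym (+-identityʳ (suc y))) (trans (sym eq) (+-identityʳ x)))))
  steps-pull (suc k) x (suc y) h (z ∷ g) y≡ eq =
    subst (Steps (x ∷ h) (suc y ∷ z ∷ g)) (sym cost)
      (steps-snoc (steps-pull k x y h (suc z ∷ g) y≡x+k (trans eq (sym (+-suc y (z + sum g)))))
        (suc zero) zero (s≤s z≤n))
    where
    y≡x+k : y ≡ x + k
    y≡x+k = suc-injective (trans y≡ (+-suc x k))
    cost : cumDist (x ∷ h) (suc y ∷ z ∷ g) ≡ cumDist (x ∷ h) (y ∷ suc z ∷ g) + 1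
    cost = begin
      cumDist (x ∷ h) (suc y ∷ z ∷ g)      ≡⟨ cumDist-sym (x ∷ h) (suc y ∷ z ∷ g) ⟩
      cumDist (suc y ∷ z ∷ g) (x ∷ h)      ≡⟨ cumDist-shift y z g x h k y≡x+k ⟩
      suc (cumDist (y ∷ suc z ∷ g) (x ∷ h)) ≡⟨ cong suc (cumDist-sym (y ∷ suc z ∷ g) (x ∷ h)) ⟩
      suc (cumDist (x ∷ h) (y ∷ suc z ∷ g)) ≡⟨ +-comm 1 _ ⟩
      cumDist (x ∷ h) (y ∷ suc z ∷ g) + 1  ∎
      where open ≡-Reasoning

-- The EMD of a family is its minority cost

deltas : ∀ {n} → ℕ → (Fin n → ℕ) → Hist n
deltas {zero} p G = []
deltas {suc n} p G = (G zero ∸ p) ∷ deltas (G zero) (G ∘ suc)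

Monotone : ∀ {n} → (Fin n → ℕ) → Set
Monotone G = ∀ {j j′} → toℕ j ≤ toℕ j′ → G j ≤ G j′

prefixSum-deltas : ∀ {n} p (G : Fin n → ℕ) → (∀ j → p ≤ G j) → Monotone G →
  ∀ j → p + prefixSum (deltas p G) j ≡ G j
prefixSum-deltas p G p≤G mono zero = m+[n∸m]≡n (p≤G zero)
prefixSum-deltas p G p≤G mono (suc j) = begin
  p + (G zero ∸ p + prefixSum (deltas (G zero) (G ∘ suc)) j)
    ≡⟨ +-assoc p _ _ ⟨
  p + (G zero ∸ p) + prefixSum (deltas (G zero) (G ∘ suc)) j
    ≡⟨ cong (_+ prefixSum (deltas (G zero) (G ∘ suc)) j) (m+[n∸m]≡n (p≤G zero)) ⟩
  G zero + prefixSum (deltas (G zero) (G ∘ suc)) j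
    ≡⟨ prefixSum-deltas (G zero) (G ∘ suc) (λ _ → mono z≤n) (mono ∘ s≤s) j ⟩
  G (suc j) ∎
  where open ≡-Reasoning

prefixSum-at-last : ∀ n → (∀ (h : Hist n) → sum h ≡ 0) ⊎ Σ (Fin n) (λ j → ∀ (h : Hist n) → prefixSum h j ≡ sum h)
prefixSum-at-last zero = inj₁ (λ { [] → refl })
prefixSum-at-last (suc n) = inj₂ (fromℕ n , prefixSum-last)

module FamilyEMD {n r} (m : ℕ) (hs : Fin r → Hist n) (total≡m : ∀ i → total (hs i) ≡ m) where

  -- Dots are indexed from 0: dot (j, k) here is the paper's dot (j + 1, k + 1).
  inDot : Fin r → Fin n → ℕ → Bool
  inDot i j k = inCum (hs i) j (suc k)

  degree : Fin n → ℕ → ℕ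
  degree j k = count (λ i → inDot i j k)

  minority : Fin n → ℕ → ℕ
  minority j k = degree j k ⊓ (r ∸ degree j k)

  minorityCost : ℕ
  minorityCost = Σfin {n} (λ j → Σfin {m} (λ k → minority j (toℕ k)))

  cum≤m : ∀ i j → cum (hs i) j ≤ m
  cum≤m i j = ≤-trans (≤-reflexive (cum≡prefixSum (hs i) j)) (≤-trans (prefixSum≤sum (hs i) j) (≤-reflexive (total≡m i)))

  Σfin-dots≡cumDist : ∀ i (G : Fin n → ℕ) (g : Hist n) → (∀ j → prefixSum g j ≡ G j) → (∀ j → G j ≤ m) →
    Σfin (λ j → Σfin {m} (λ k → ∣ ind (inDot i j (toℕ k)) - ind (suc (toℕ k) ≤ᵇ G j) ∣)) ≡ cumDist (hs i) g
  Σfin-dots≡cumDist i G g g≡G G≤m = Σfin-cong λ j → begin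
    Σfin {m} (λ k → ∣ ind (inDot i j (toℕ k)) - ind (suc (toℕ k) ≤ᵇ G j) ∣)
      ≡⟨ Σfin-∣ind≤ᵇ-ind≤ᵇ∣ m (cum (hs i) j) (G j) ⟩
    ∣ cum (hs i) j ⊓ m - G j ⊓ m ∣
      ≡⟨ cong₂ ∣_-_∣ (m≤n⇒m⊓n≡m (cum≤m i j)) (m≤n⇒m⊓n≡m (G≤m j)) ⟩
    ∣ cum (hs i) j - G j ∣
      ≡⟨ cong₂ ∣_-_∣ (cum≡prefixSum (hs i) j) (sym (g≡G j)) ⟩
    ∣ prefixSum (hs i) j - prefixSum g j ∣ ∎
    where open ≡-Reasoning

  minorityCost≤ : ∀ w → Achievable hs w → minorityCost ≤ w
  minorityCost≤ w (g , ws , steps , Σws≡w) = begin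
    minorityCost
      ≤⟨ Σfin-mono (λ j → Σfin-mono (λ k → minority≤disagreement (λ i → inDot i j (toℕ k)) (gDot j k))) ⟩
    Σfin (λ j → Σfin (λ k → Σfin (λ i → disagree i j k)))
      ≡⟨ Σfin-rotate disagree ⟩
    Σfin (λ i → Σfin (λ j → Σfin (λ k → disagree i j k)))
      ≡⟨ Σfin-cong (λ i → Σfin-cong (λ j → Σfin-∣ind≤ᵇ-ind≤ᵇ∣ m (cum (hs i) j) (cum g j))) ⟩
    Σfin (λ i → Σfin (λ j → ∣ cum (hs i) j ⊓ m - cum g j ⊓ m ∣))
      ≤⟨ Σfin-mono (λ i → Σfin-mono (λ j → ∣m⊓o-n⊓o∣≤∣m-n∣ (cum (hs i) j) (cum g j) m)) ⟩
    Σfin (λ i → Σfin (λ j → ∣ cum (hs i) j - cum g j ∣))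
      ≡⟨ Σfin-cong (λ i → Σfin-cong (λ j → cong₂ ∣_-_∣ (cum≡prefixSum (hs i) j) (cum≡prefixSum g j))) ⟩
    Σfin (λ i → cumDist (hs i) g)
      ≤⟨ Σfin-mono (cumDist≤work ∘ steps) ⟩
    Σfin ws ≡⟨ Σws≡w ⟩
    w ∎
    where
    open ≤-Reasoning
    gDot : Fin n → Fin m → Bool
    gDot j k = suc (toℕ k) ≤ᵇ cum g j
    disagree : Fin r → Fin n → Fin m → ℕ
    disagree i j k = ∣ ind (inDot i j (toℕ k)) - ind (gDot j k) ∣

  degree-antitone : ∀ j k → degree j (suc k) ≤ degree j k
  degree-antitone j k = Σfin-mono {r} (λ i → ind-≤ᵇ-mono (n≤1+n (suc k)) (≤-refl {cum (hs i) j}))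

  degree-mono : ∀ {j j′} k → toℕ j ≤ toℕ j′ → degree j k ≤ degree j′ k
  degree-mono {j} {j′} k j≤j′ = Σfin-mono (λ i → ind-≤ᵇ-mono ≤-refl (begin
    cum (hs i) j       ≡⟨ cum≡prefixSum (hs i) j ⟩
    prefixSum (hs i) j ≤⟨ prefixSum-mono (hs i) j≤j′ ⟩
    prefixSum (hs i) j′ ≡⟨ cum≡prefixSum (hs i) j′ ⟨
    cum (hs i) j′      ∎))
    where open ≤-Reasoning

  majorityDot : Fin n → ℕ → Bool
  majorityDot j k = majority (λ i → inDot i j k)

  majorityDot-mono : ∀ {j j′ k k′} → degree j k ≤ degree j′ k′ → T (majorityDot j k) → T (majorityDot j′ k′)
  majorityDot-mono {j} {j′} {k} {k′} = majority-mono {B = λ i → inDot i j k} {B′ = λ i → inDot i j′ k′}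

  majorityCum : Fin n → ℕ
  majorityCum j = Σfin {m} (λ k → ind (majorityDot j (toℕ k)))

  majorityCum-mono : Monotone majorityCum
  majorityCum-mono j≤j′ = Σfin-mono {m} (λ k → ind-mono (majorityDot-mono (degree-mono (toℕ k) j≤j′)))

  majorityCum-full : ∀ j → (∀ i → cum (hs i) j ≡ m) → majorityCum j ≡ m
  majorityCum-full j full = count-all (λ k → majorityDot j (toℕ k)) (λ k → ≤⇒≤ᵇ (begin
    r                                 ≡⟨ count-all (λ i → inDot i j (toℕ k)) (λ i → ≤⇒≤ᵇ (subst (suc (toℕ k) ≤_) (sym (full i)) (toℕ<n k))) ⟨
    degree j (toℕ k)                  ≤⟨ m≤m+n _ _ ⟩
    degree j (toℕ k) + degree j (toℕ k) ∎))
    where open ≤-Reasoning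

  majorityHist : Hist n
  majorityHist = deltas 0 majorityCum

  prefixSum-majorityHist : ∀ j → prefixSum majorityHist j ≡ majorityCum j
  prefixSum-majorityHist = prefixSum-deltas 0 majorityCum (λ _ → z≤n) majorityCum-mono

  sum≡sum-majorityHist : ∀ i → sum (hs i) ≡ sum majorityHist
  sum≡sum-majorityHist i with prefixSum-at-last n
  ... | inj₁ sum≡0 = trans (sum≡0 (hs i)) (sym (sum≡0 majorityHist))
  ... | inj₂ (last , atLast) = begin
    sum (hs i)                 ≡⟨ total≡m i ⟩
    m                          ≡⟨ majorityCum-full last (λ i′ → trans (cum≡prefixSum (hs i′) last)
                                    (trans (atLast (hs i′)) (total≡m i′))) ⟨
    majorityCum last           ≡⟨ prefixSum-majorityHist last ⟨
    prefixSum majorityHist last ≡⟨ atLast majorityHist ⟩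
    sum majorityHist           ∎
    where open ≡-Reasoning

  cumDist-majorityHist : Σfin (λ i → cumDist (hs i) majorityHist) ≡ minorityCost
  cumDist-majorityHist = begin
    Σfin (λ i → cumDist (hs i) majorityHist)
      ≡⟨ Σfin-cong (λ i → Σfin-dots≡cumDist i majorityCum majorityHist prefixSum-majorityHist (λ j → count≤ (λ k → majorityDot j (toℕ k)))) ⟨
    Σfin (λ i → Σfin (λ j → Σfin {m} (λ k → ∣ ind (inDot i j (toℕ k)) - ind (suc (toℕ k) ≤ᵇ majorityCum j) ∣)))
      ≡⟨ Σfin-cong (λ i → Σfin-cong (λ j → Σfin-cong (λ k → cong (λ b → ∣ ind (inDot i j (toℕ k)) - b ∣)
           (ind≤ᵇ-count-antitone m (majorityDot j)
              (λ k → majorityDot-mono (degree-antitone j k)) k)))) ⟩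
    Σfin (λ i → Σfin (λ j → Σfin (λ k → disagree i j k)))
      ≡⟨ Σfin-rotate disagree ⟨
    Σfin (λ j → Σfin (λ k → Σfin (λ i → disagree i j k)))
      ≡⟨ Σfin-cong {n} (λ j → Σfin-cong {m} (λ k → disagreement-majority (λ i → inDot i j (toℕ k)))) ⟩
    minorityCost ∎
    where
    open ≡-Reasoning
    disagree : Fin r → Fin n → Fin m → ℕ
    disagree i j k = ∣ ind (inDot i j (toℕ k)) - ind (majorityDot j (toℕ k)) ∣

  achievable-minorityCost : Achievable hs minorityCost
  achievable-minorityCost = majorityHist , (λ i → cumDist (hs i) majorityHist) ,
    (λ i → steps-cumDist (hs i) majorityHist (sum≡sum-majorityHist i)) , cumDist-majorityHist

  IsEMD⇒≡minorityCost : ∀ {w} → IsEMD hs w → w ≡ minorityCost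
  IsEMD⇒≡minorityCost (achievable , minimal) =
    ≤-antisym (minimal minorityCost achievable-minorityCost) (minorityCost≤ _ achievable)

-- Arithmetic of the degree classes

lsum-applyUpTo≡Σfin : ∀ L (f : ℕ → ℕ) → lsum (L.applyUpTo f L) ≡ Σfin {L} (f ∘ toℕ)
lsum-applyUpTo≡Σfin zero f = refl
lsum-applyUpTo≡Σfin (suc L) f = cong (f 0 +_) (lsum-applyUpTo≡Σfin L (f ∘ suc))

Σfin-select : ∀ L (f : ℕ → ℕ) N → N < L → Σfin {L} (λ i → f (toℕ i) * ind (N ≡ᵇ toℕ i)) ≡ f N
Σfin-select (suc L) f zero _ = begin
  f 0 * 1 + Σfin {L} (λ i → f (suc (toℕ i)) * 0) ≡⟨ cong₂ _+_ (*-identityʳ (f 0)) (Σfin-zero {L} (*-zeroʳ ∘ f ∘ suc ∘ toℕ)) ⟩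
  f 0 + 0                                        ≡⟨ +-identityʳ (f 0) ⟩
  f 0                                            ∎
  where open ≡-Reasoning
Σfin-select (suc L) f (suc N) (s≤s N<L) =
  trans (cong (_+ Σfin {L} (λ i → f (suc (toℕ i)) * ind (N ≡ᵇ toℕ i))) (*-zeroʳ (f 0))) (Σfin-select L (f ∘ suc) N N<L)

d*x≡x*y+x*[x∸1] : ∀ d x y → x + y ≡ suc d → d * x ≡ x * y + x * (x ∸ 1)
d*x≡x*y+x*[x∸1] d zero y _ = *-zeroʳ d
d*x≡x*y+x*[x∸1] d (suc x) y x+y≡1+d rewrite sym (suc-injective x+y≡1+d) =
  solve 2 (λ x y → (x :+ y) :* (con 1 :+ x) := (con 1 :+ x) :* y :+ (con 1 :+ x) :* x) refl x y

-- The pairwise terms count x·y; the rest of d·min(x, y) is the correction min(x, y)·(min(x, y) − 1).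
d*[x⊓y]≡x*y+[x⊓y]*[x⊓y∸1] : ∀ d x y → x + y ≡ suc d → d * (x ⊓ y) ≡ x * y + (x ⊓ y) * (x ⊓ y ∸ 1)
d*[x⊓y]≡x*y+[x⊓y]*[x⊓y∸1] d x y x+y≡1+d with ≤-total x y
... | inj₁ x≤y rewrite m≤n⇒m⊓n≡m x≤y = d*x≡x*y+x*[x∸1] d x y x+y≡1+d
... | inj₂ y≤x rewrite m≥n⇒m⊓n≡n y≤x | *-comm x y = d*x≡x*y+x*[x∸1] d y x (trans (+-comm y x) x+y≡1+d)

m+m≡m*2 : ∀ m → m + m ≡ m * 2
m+m≡m*2 m = solve 1 (λ m → m :+ m := m :* con 2) refl m

K≤ceilHalf⇒K+K≤1+d : ∀ d K → K ≤ ceilHalf d → K + K ≤ suc d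
K≤ceilHalf⇒K+K≤1+d d K K≤ = begin
  K + K                      ≤⟨ +-mono-≤ K≤ K≤ ⟩
  (d + 1) / 2 + (d + 1) / 2  ≡⟨ m+m≡m*2 ((d + 1) / 2) ⟩
  (d + 1) / 2 * 2            ≤⟨ m/n*n≤m (d + 1) 2 ⟩
  d + 1                      ≡⟨ +-comm d 1 ⟩
  suc d                      ∎
  where open ≤-Reasoning

K+K≤1+d⇒K≤ceilHalf : ∀ d K → K + K ≤ suc d → K ≤ ceilHalf d
K+K≤1+d⇒K≤ceilHalf d K K+K≤ = begin
  K              ≡⟨ m*n/n≡m K 2 ⟨
  K * 2 / 2      ≤⟨ /-monoˡ-≤ 2 (begin
                      K * 2 ≡⟨ m+m≡m*2 K ⟨
                      K + K ≤⟨ K+K≤ ⟩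
                      suc d ≡⟨ +-comm 1 d ⟩
                      d + 1 ∎) ⟩
  (d + 1) / 2    ∎
  where open ≤-Reasoning

-- The dot condition of countDeg, as a function of the degree x of the dot.
degreeClass : ℕ → ℕ → ℕ → Bool
degreeClass d K x = (1 ≤ᵇ x) ∧ ((x ≡ᵇ K) ∨ (x ≡ᵇ (d + 1 ∸ K)))

degreeClass⇔ : ∀ d K x → 1 ≤ K → K + K ≤ suc d → x ≤ suc d →
  T (degreeClass d K x) ⇔ (x ⊓ (suc d ∸ x) ≡ K)
degreeClass⇔ d K x 1≤K K+K≤ x≤ = mk⇔ to from
  where
  K≤r∸K : K ≤ suc d ∸ K
  K≤r∸K = m+n≤o⇒m≤o∸n K K+K≤
  to : T (degreeClass d K x) → x ⊓ (suc d ∸ x) ≡ K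
  to t with Equivalence.to T-∨ (proj₂ (Equivalence.to T-∧ t))
  ... | inj₁ x≡K = subst (λ y → y ⊓ (suc d ∸ y) ≡ K) (sym (≡ᵇ⇒≡ x K x≡K)) (m≤n⇒m⊓n≡m K≤r∸K)
  ... | inj₂ x≡r∸K = subst (λ y → y ⊓ (suc d ∸ y) ≡ K) (sym (trans (≡ᵇ⇒≡ x (d + 1 ∸ K) x≡r∸K) (cong (_∸ K) (+-comm d 1))))
          (trans (cong ((suc d ∸ K) ⊓_) (m∸[m∸n]≡n (≤-trans (m≤m+n K K) K+K≤))) (m≥n⇒m⊓n≡n K≤r∸K))
  from : x ⊓ (suc d ∸ x) ≡ K → T (degreeClass d K x)
  from x⊓≡K = Equivalence.from T-∧ (≤⇒≤ᵇ 1≤x , Equivalence.from T-∨ (x≡K-or-r∸K (⊓-sel x (suc d ∸ x))))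
    where
    1≤x : 1 ≤ x
    1≤x = ≤-trans 1≤K (subst (_≤ x) x⊓≡K (m⊓n≤m x (suc d ∸ x)))
    x≡K-or-r∸K : (x ⊓ (suc d ∸ x) ≡ x) ⊎ (x ⊓ (suc d ∸ x) ≡ suc d ∸ x) → T (x ≡ᵇ K) ⊎ T (x ≡ᵇ (d + 1 ∸ K))
    x≡K-or-r∸K (inj₁ ≡x) = inj₁ (≡⇒≡ᵇ x K (trans (sym ≡x) x⊓≡K))
    x≡K-or-r∸K (inj₂ ≡r∸x) = inj₂ (≡⇒≡ᵇ x (d + 1 ∸ K) (begin
      x                   ≡⟨ m∸[m∸n]≡n x≤ ⟨
      suc d ∸ (suc d ∸ x) ≡⟨ cong (suc d ∸_) (trans (sym ≡r∸x) x⊓≡K) ⟩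
      suc d ∸ K           ≡⟨ cong (_∸ K) (+-comm 1 d) ⟩
      d + 1 ∸ K           ∎))
      where open ≡-Reasoning

ind-degreeClass : ∀ d K x → 1 ≤ K → K + K ≤ suc d → x ≤ suc d →
  ind (degreeClass d K x) ≡ ind (x ⊓ (suc d ∸ x) ≡ᵇ K)
ind-degreeClass d K x 1≤K K+K≤ x≤ = ≤-antisym
  (ind-mono (≡⇒≡ᵇ _ K ∘ Equivalence.to class⇔))
  (ind-mono (Equivalence.from class⇔ ∘ ≡ᵇ⇒≡ _ K))
  where class⇔ = degreeClass⇔ d K x 1≤K K+K≤ x≤

Σfin-correction : ∀ d x → x ≤ suc d →
  Σfin {ceilHalf d ∸ 1} (λ i → (2 + toℕ i) * (1 + toℕ i) * ind (degreeClass d (2 + toℕ i) x))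
    ≡ (x ⊓ (suc d ∸ x)) * (x ⊓ (suc d ∸ x) ∸ 1)
Σfin-correction d x x≤ = trans
  (Σfin-cong (λ i → cong ((2 + toℕ i) * (1 + toℕ i) *_)
    (ind-degreeClass d (2 + toℕ i) x (s≤s z≤n) (K≤ceilHalf⇒K+K≤1+d d (2 + toℕ i) (2+i≤ (toℕ<n i))) x≤)))
  (select (x ⊓ (suc d ∸ x)) c+c≤1+d)
  where
  2+i≤ : ∀ {q i} → i < q ∸ 1 → 2 + i ≤ q
  2+i≤ {suc q} i<q = s≤s i<q
  c+c≤1+d : x ⊓ (suc d ∸ x) + x ⊓ (suc d ∸ x) ≤ suc d
  c+c≤1+d = ≤-trans (+-mono-≤ (m⊓n≤m x (suc d ∸ x)) (m⊓n≤n x (suc d ∸ x))) (≤-reflexive (m+[n∸m]≡n x≤))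
  select : ∀ M → M + M ≤ suc d →
    Σfin {ceilHalf d ∸ 1} (λ i → (2 + toℕ i) * (1 + toℕ i) * ind (M ≡ᵇ 2 + toℕ i)) ≡ M * (M ∸ 1)
  select 0 _ = Σfin-zero {ceilHalf d ∸ 1} (λ i → *-zeroʳ ((2 + toℕ i) * (1 + toℕ i)))
  select 1 _ = Σfin-zero {ceilHalf d ∸ 1} (λ i → *-zeroʳ ((2 + toℕ i) * (1 + toℕ i)))
  select (suc (suc N)) M+M≤ =
    Σfin-select (ceilHalf d ∸ 1) (λ i → (2 + i) * (1 + i)) N (∸-monoˡ-≤ 1 (K+K≤1+d⇒K≤ceilHalf d (2 + N) M+M≤))

total-pair : ∀ {n m} (h h′ : Hist n) → total h ≡ m → total h′ ≡ m → ∀ t → total (pair h h′ t) ≡ m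
total-pair h h′ th th′ zero = th
total-pair h h′ th th′ (suc zero) = th′

emd-pair : ∀ {n m} (h h′ : Hist n) → total h ≡ m → total h′ ≡ m → ∀ {e} → IsEMD (pair h h′) e →
  e ≡ Σfin {n} (λ j → Σfin {m} (λ k → ∣ ind (inCum h j (suc (toℕ k))) - ind (inCum h′ j (suc (toℕ k))) ∣))
emd-pair {n} {m} h h′ th th′ isEMD =
  trans (IsEMD⇒≡minorityCost isEMD)
    (Σfin-cong {n} (λ j → Σfin-cong {m} (λ k → minority-pair (inCum h j (suc (toℕ k))) (inCum h′ j (suc (toℕ k))))))
  where
  open FamilyEMD m (pair h h′) (total-pair h h′ th th′)
  minority-pair : ∀ b b′ → (ind b + (ind b′ + 0)) ⊓ (2 ∸ (ind b + (ind b′ + 0))) ≡ ∣ ind b - ind b′ ∣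
  minority-pair true true = refl
  minority-pair true false = refl
  minority-pair false true = refl
  minority-pair false false = refl

module DegreeDecomposition {n d} (m : ℕ) (hs : Fin (suc d) → Hist n) (total≡m : ∀ i → total (hs i) ≡ m) where
  open FamilyEMD m hs total≡m

  pairTerm : Fin n → Fin m → ℕ
  pairTerm j k = degree j (toℕ k) * (suc d ∸ degree j (toℕ k))

  correction : Fin n → Fin m → ℕ
  correction j k = minority j (toℕ k) * (minority j (toℕ k) ∸ 1)

  degree≤ : ∀ j k → degree j k ≤ suc d
  degree≤ j k = count≤ (λ i → inDot i j k)

  d*minorityCost≡ : d * minorityCost ≡ Σfin (λ j → Σfin (pairTerm j)) + Σfin (λ j → Σfin (correction j))
  d*minorityCost≡ = begin
    d * minorityCost
      ≡⟨ *-distribˡ-Σfin² d (λ j (k : Fin m) → minority j (toℕ k)) ⟩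
    Σfin {n} (λ j → Σfin {m} (λ k → d * minority j (toℕ k)))
      ≡⟨ Σfin-cong {n} (λ j → Σfin-cong {m} (λ k → split j (toℕ k))) ⟩
    Σfin (λ j → Σfin (λ k → pairTerm j k + correction j k))
      ≡⟨ Σfin²-distrib-+ pairTerm correction ⟩
    Σfin (λ j → Σfin (pairTerm j)) + Σfin (λ j → Σfin (correction j)) ∎
    where
    open ≡-Reasoning
    split : ∀ j k → d * minority j k ≡ degree j k * (suc d ∸ degree j k) + minority j k * (minority j k ∸ 1)
    split j k = d*[x⊓y]≡x*y+[x⊓y]*[x⊓y∸1] d (degree j k) (suc d ∸ degree j k) (m+[n∸m]≡n (degree≤ j k))

  sumPairs≡ : ∀ e → (∀ i i′ → toℕ i < toℕ i′ → IsEMD (pair (hs i) (hs i′)) (e i i′)) →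
    sumPairs e ≡ Σfin (λ j → Σfin (pairTerm j))
  sumPairs≡ e isEMD = begin
    sumPairs e
      ≡⟨ Σfin-cong (λ i → Σfin-cong (λ i′ → trans (emd-if i i′) (Σfin²-if (toℕ i <ᵇ toℕ i′) (disagree i i′)))) ⟩
    Σfin (λ i → Σfin (λ i′ → Σfin (λ j → Σfin (λ k → disagree< i i′ j k))))
      ≡⟨ Σfin-cong (λ i → Σfin-rotate (λ i′ j k → disagree< i i′ j k)) ⟨
    Σfin (λ i → Σfin (λ j → Σfin (λ k → Σfin (λ i′ → disagree< i i′ j k))))
      ≡⟨ Σfin-rotate (λ i j k → Σfin (λ i′ → disagree< i i′ j k)) ⟨
    Σfin (λ j → Σfin (λ k → Σfin (λ i → Σfin (λ i′ → disagree< i i′ j k))))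
      ≡⟨ Σfin-cong {n} (λ j → Σfin-cong {m} (λ k → Σfin-pairs-∣ind-ind∣ (λ i → inDot i j (toℕ k)))) ⟩
    Σfin (λ j → Σfin (pairTerm j)) ∎
    where
    open ≡-Reasoning
    disagree : Fin (suc d) → Fin (suc d) → Fin n → Fin m → ℕ
    disagree i i′ j k = ∣ ind (inDot i j (toℕ k)) - ind (inDot i′ j (toℕ k)) ∣
    disagree< : Fin (suc d) → Fin (suc d) → Fin n → Fin m → ℕ
    disagree< i i′ j k = if toℕ i <ᵇ toℕ i′ then disagree i i′ j k else 0
    emd-if : ∀ i i′ → (if toℕ i <ᵇ toℕ i′ then e i i′ else 0)
                    ≡ (if toℕ i <ᵇ toℕ i′ then Σfin (λ j → Σfin (disagree i i′ j)) else 0)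
    emd-if i i′ with toℕ i <ᵇ toℕ i′ in i<ᵇi′
    ... | false = refl
    ... | true = emd-pair (hs i) (hs i′) (total≡m i) (total≡m i′)
                   (isEMD i i′ (<ᵇ⇒< (toℕ i) (toℕ i′) (subst T (sym i<ᵇi′) tt)))
    Σfin²-if : ∀ b (f : Fin n → Fin m → ℕ) →
      (if b then Σfin (λ j → Σfin (f j)) else 0) ≡ Σfin (λ j → Σfin (λ k → if b then f j k else 0))
    Σfin²-if b f = trans (Σfin-if b (λ j → Σfin (f j))) (Σfin-cong (λ j → Σfin-if b (f j)))

  sumFrom2≡ : sumFrom2 (ceilHalf d) (λ K → K * (K ∸ 1) * countDeg m hs K) ≡ Σfin (λ j → Σfin (correction j))
  sumFrom2≡ = begin
    sumFrom2 (ceilHalf d) (λ K → K * (K ∸ 1) * countDeg m hs K)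
      ≡⟨ lsum-applyUpTo≡Σfin (ceilHalf d ∸ 1) (λ i → (2 + i) * (1 + i) * countDeg m hs (2 + i)) ⟩
    Σfin {ceilHalf d ∸ 1} (λ i → (2 + toℕ i) * (1 + toℕ i) * countDeg m hs (2 + toℕ i))
      ≡⟨ Σfin-cong (λ i → *-distribˡ-Σfin² ((2 + toℕ i) * (1 + toℕ i)) (λ j k → inClass i j k)) ⟩
    Σfin (λ i → Σfin (λ j → Σfin (λ k → (2 + toℕ i) * (1 + toℕ i) * inClass i j k)))
      ≡⟨ Σfin-rotate (λ i j k → (2 + toℕ i) * (1 + toℕ i) * inClass i j k) ⟨
    Σfin (λ j → Σfin (λ k → Σfin (λ i → (2 + toℕ i) * (1 + toℕ i) * inClass i j k)))
      ≡⟨ Σfin-cong {n} (λ j → Σfin-cong {m} (λ k → Σfin-correction d (degree j (toℕ k)) (degree≤ j (toℕ k)))) ⟩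
    Σfin (λ j → Σfin (correction j)) ∎
    where
    open ≡-Reasoning
    inClass : Fin (ceilHalf d ∸ 1) → Fin n → Fin m → ℕ
    inClass i j k = ind (degreeClass d (2 + toℕ i) (degree j (toℕ k)))

corollary4p2 : (d n m : ℕ) → 1 ≤ d → (hs : Fin (suc d) → Hist n) →
    ((i : Fin (suc d)) → total (hs i) ≡ m) →
    (e : Fin (suc d) → Fin (suc d) → ℕ) →
    ((i j : Fin (suc d)) → toℕ i < toℕ j → IsEMD (pair (hs i) (hs j)) (e i j)) →
    (w : ℕ) → IsEMD hs w →
    d * w ≡ sumPairs e + sumFrom2 (ceilHalf d) (λ k → k * (k ∸ 1) * countDeg m hs k)
corollary4p2 d n m _ hs total≡m e pairIsEMD w isEMD = begin
  d * w                     ≡⟨ cong (d *_) (IsEMD⇒≡minorityCost isEMD) ⟩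
  d * minorityCost          ≡⟨ d*minorityCost≡ ⟩
  Σfin (λ j → Σfin (pairTerm j)) + Σfin (λ j → Σfin (correction j))
                            ≡⟨ cong₂ _+_ (sumPairs≡ e pairIsEMD) sumFrom2≡ ⟨
  sumPairs e + sumFrom2 (ceilHalf d) (λ k → k * (k ∸ 1) * countDeg m hs k) ∎
  where
  open ≡-Reasoning
  open FamilyEMD m hs total≡m
  open DegreeDecomposition m hs total≡m
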